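{- Let $N\geq 1$ be an integer. There exists an effectively computable constant $C(N)>0$, depending only on $N$, such that for any endomorphism $f=(f_1,\ldots,f_N):\mathbb{A}^N\to\mathbb{A}^N$ defined over $\mathbb{Z}$ (i.e. $f_i\in\mathbb{Z}[x_1,\ldots,x_N]$) and any periodic point $P\in\mathbb{A}^N(\mathbb{Z})=\mathbb{Z}^N$ of $f$, the size $|\mathcal{O}_f(P)|$ of the orbit satisfies $|\mathcal{O}_f(P)|\leq C(N)$.
   Context: A point $P$ is $f$-periodic if $f^n(P)=P$ for some integer $n\geq1$; its orbit is $\mathcal{O}_f(P)=\{f^k(P):k\geq 0\}$. -}

module Defs where

open import Data.Nat using (ℕ; zero; suc; _≤_)
open import Data.Integer as ℤ using (ℤ)
open import Data.Fin using (Fin)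
open import Data.Vec using (Vec; lookup; tabulate)
open import Data.List using (List; length)
open import Data.List.Relation.Unary.All using (All)
open import Data.List.Relation.Unary.Unique.Propositional using (Unique)
open import Data.Product using (Σ; _×_)
open import Relation.Binary.PropositionalEquality using (_≡_)

data Poly (N : ℕ) : Set where
  con  : ℤ → Poly N
  var  : Fin N → Poly N
  _⊕_  : Poly N → Poly N → Poly N
  _⊗_  : Poly N → Poly N → Poly N

eval : {N : ℕ} → Poly N → Vec ℤ N → ℤ
eval (con c) x = c
eval (var i) x = lookup x i
eval (p ⊕ q) x = eval p x ℤ.+ eval q x
eval (p ⊗ q) x = eval p x ℤ.* eval q x

Endo : ℕ → Set
Endo N = Fin N → Poly N

apply : {N : ℕ} → Endo N → Vec ℤ N → Vec ℤ N
apply f x = tabulate (λ i → eval (f i) x)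

iter : {N : ℕ} → Endo N → ℕ → Vec ℤ N → Vec ℤ N
iter f zero    x = x
iter f (suc n) x = apply f (iter f n x)

Periodic : {N : ℕ} → Endo N → Vec ℤ N → Set
Periodic f P = Σ ℕ (λ n → (1 ≤ n) × (iter f n P ≡ P))

InOrbit : {N : ℕ} → Endo N → Vec ℤ N → Vec ℤ N → Set
InOrbit f P Q = Σ ℕ (λ k → iter f k P ≡ Q)

OrbitSizeAtMost : {N : ℕ} → Endo N → Vec ℤ N → ℕ → Set
OrbitSizeAtMost f P c =
  (xs : List (Vec ℤ _)) → Unique xs → All (InOrbit f P) xs → length xs ≤ c

-- By pigeonhole there is m ≤ 9^N with f^m(P) ≡ P (mod 9); put g = f^m.  All points of the
-- g-orbit of P are ≡ P (mod 9), so by Taylor's formula, if two of them agree modulo c with 9 ∣ c,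
-- then modulo 9c applying g maps their difference by Λ = Dg(P).  For E = (3^N)! the powers of Λ
-- are stable modulo 3 from Λ^E on.  Suppose g^E(P) ≠ P and write
-- g^(3^s E)(P) − P = 3^(2+ν) w with 3 ∤ w.  The linearisation gives
-- g^(k 3^s E)(P) − P ≡ k 3^(2+ν) w (mod 3^(3+ν)), so 3^(s+1) divides the period of P, and a
-- second-order computation shows that g^(3^(s+1) E)(P) − P has the same shape.  Hence every
-- power of 3 divides the period, which is absurd; so f^(E m)(P) = P and the orbit has at most
-- (3^N)! 9^N points.

module Submission where

open import Data.Nat using (ℕ; _≤_; _<_)
open import Data.Integer using (ℤ)
open import Data.Vec using (Vec)
open import Data.Product using (Σ; _×_)
open import Defs

open import Data.Empty using (⊥-elim)
open import Data.Fin as Fin using (Fin; toℕ; fromℕ<; combine; remQuot)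
import Data.Fin.Properties as Finₚ
open import Data.Integer as ℤ using (+_; _+_; _-_; _*_; -_; 0ℤ; ∣_∣)
open import Data.Integer.DivMod using (_%ℕ_; _/ℕ_; n%ℕd<d; a≡a%ℕn+[a/ℕn]*n)
open import Data.Integer.Divisibility.Signed
  using (_∣_; divides; ∣-refl; ∣-trans; ∣-reflexive; ∣m∣n⇒∣m+n; ∣m⇒∣m*n; ∣n⇒∣m*n; ∣m⇒∣-m; _∣?_;
         *-monoˡ-∣; *-monoʳ-∣; *-cancelˡ-∣; *-cancelʳ-∣; ∣ᵤ⇒∣; ∣⇒∣ᵤ)
import Data.Integer.Properties as ℤₚ
open import Data.Integer.Tactic.RingSolver using (solve-∀)
open import Data.List as List using (List; length; _∷_)
open import Data.List.Membership.Propositional.Properties using (∈-lookup)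
open import Data.List.Relation.Unary.All as All using (All)
open import Data.List.Relation.Unary.AllPairs using (_∷_)
open import Data.List.Relation.Unary.Unique.Propositional using (Unique)
open import Data.Nat as ℕ using (zero; suc; NonZero; _!; _∸_; z<s)
open import Data.Nat.DivMod using (_%_; _/_; m%n<n; m≡m%n+[m/n]*n)
import Data.Nat.Divisibility as ℕ∣
open ℕ∣ using (divides-refl) renaming (_∣_ to _∣ₙ_)
open import Data.Nat.GeneralisedArithmetic using (fold; fold-+)
open import Data.Nat.Primality using (Prime; prime?; euclidsLemma)
import Data.Nat.Properties as ℕₚ
import Data.Nat.Tactic.RingSolver as ℕ-Solver
open import Data.Product using (_,_; proj₁; proj₂; ∃; ∃₂)
open import Data.Sum using (inj₁; inj₂)
open import Data.Vec using (lookup; tabulate; map; zipWith; []; _∷_)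
open import Data.Vec.Properties
  using (≡-dec; lookup-map; lookup-zipWith; lookup∘tabulate; tabulate∘lookup; tabulate-cong)
open import Function using (_∘_)
open import Relation.Binary.Bundles using (Setoid)
open import Relation.Binary.PropositionalEquality
import Relation.Binary.Reasoning.Setoid as SetoidReasoning
open import Relation.Nullary using (¬_; yes; no)
open import Relation.Nullary.Decidable using (toWitness)

private
  variable
    N : ℕ
    M c k : ℤ
    u v w x y : Vec ℤ N

∣-* : ∀ {a b m n} → a ∣ m → b ∣ n → a * b ∣ m * n
∣-* {b = b} {m} a∣m b∣n = ∣-trans (*-monoˡ-∣ b a∣m) (*-monoʳ-∣ m b∣n)

∣i-i : ∀ i → M ∣ i - i
∣i-i i = subst (_ ∣_) (sym (ℤₚ.+-inverseʳ i)) (divides 0ℤ refl)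

prime-∣-*-coprime : ∀ {p q x} → Prime p → + p ∣ + q * x → ¬ p ∣ₙ q → + p ∣ x
prime-∣-*-coprime {p} {q} {x} p-prime p∣qx p∤q
  with euclidsLemma q ∣ x ∣ p-prime (subst (p ∣ₙ_) (ℤₚ.abs-* (+ q) x) (∣⇒∣ᵤ p∣qx))
... | inj₁ p∣q = ⊥-elim (p∤q p∣q)
... | inj₂ p∣x = ∣ᵤ⇒∣ p∣x

+-minus-interchange : ∀ a b c d → (a - b) + (c - d) ≡ (a + c) - (b + d)
+-minus-interchange = solve-∀

infixl 6 _+ᵛ_ _-ᵛ_
infixr 7 _·ᵛ_
infix 4 _∣ᵛ_ _≡ᵛ_mod_

_+ᵛ_ _-ᵛ_ : Vec ℤ N → Vec ℤ N → Vec ℤ N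
_+ᵛ_ = zipWith _+_
_-ᵛ_ = zipWith _-_

_·ᵛ_ : ℤ → Vec ℤ N → Vec ℤ N
k ·ᵛ u = map (k *_) u

-- Records rather than functions, so that the vectors can be inferred from these types.
record _∣ᵛ_ (M : ℤ) (u : Vec ℤ N) : Set where
  constructor ∣ᵛ-intro
  field ∣ᵛ-at : ∀ i → M ∣ lookup u i
open _∣ᵛ_ public

record _≡ᵛ_mod_ (u w : Vec ℤ N) (M : ℤ) : Set where
  constructor ≡ᵛ-intro
  field ≡ᵛ-at : ∀ i → M ∣ lookup u i - lookup w i
open _≡ᵛ_mod_ public

lookup-ext : (∀ i → lookup u i ≡ lookup w i) → u ≡ w
lookup-ext {u = u} {w} eq = trans (sym (tabulate∘lookup u)) (trans (tabulate-cong eq) (tabulate∘lookup w))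

lookup--ᵛ : ∀ (u w : Vec ℤ N) i → lookup (u -ᵛ w) i ≡ lookup u i - lookup w i
lookup--ᵛ u w i = lookup-zipWith _-_ i u w

lookup-+ᵛ : ∀ (u w : Vec ℤ N) i → lookup (u +ᵛ w) i ≡ lookup u i + lookup w i
lookup-+ᵛ u w i = lookup-zipWith _+_ i u w

lookup-·ᵛ : ∀ k (u : Vec ℤ N) i → lookup (k ·ᵛ u) i ≡ k * lookup u i
lookup-·ᵛ k u i = lookup-map i (k *_) u

≢⇒lookup--ᵛ≢0 : u ≢ w → ∃ λ i → lookup (u -ᵛ w) i ≢ 0ℤ
≢⇒lookup--ᵛ≢0 {u = u} {w = w} u≢w = Finₚ.¬∀⟶∃¬ _ _ (λ i → lookup (u -ᵛ w) i ℤ.≟ 0ℤ) λ all-zero →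
  u≢w (lookup-ext λ i → ℤₚ.i-j≡0⇒i≡j _ _ (trans (sym (lookup--ᵛ u w i)) (all-zero i)))

≡ᵛ⇒∣ᵛ-ᵛ : u ≡ᵛ w mod M → M ∣ᵛ u -ᵛ w
≡ᵛ⇒∣ᵛ-ᵛ {u = u} {w} (≡ᵛ-intro eq) = ∣ᵛ-intro λ i → subst (_ ∣_) (sym (lookup--ᵛ u w i)) (eq i)

∣ᵛ-ᵛ⇒≡ᵛ : M ∣ᵛ u -ᵛ w → u ≡ᵛ w mod M
∣ᵛ-ᵛ⇒≡ᵛ {u = u} {w} (∣ᵛ-intro d) = ≡ᵛ-intro λ i → subst (_ ∣_) (lookup--ᵛ u w i) (d i)

≡ᵛ-refl : u ≡ᵛ u mod M
≡ᵛ-refl {u = u} = ≡ᵛ-intro λ i → ∣i-i (lookup u i)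

≡ᵛ-reflexive : u ≡ w → u ≡ᵛ w mod M
≡ᵛ-reflexive refl = ≡ᵛ-refl

≡ᵛ-sym : u ≡ᵛ w mod M → w ≡ᵛ u mod M
≡ᵛ-sym {u = u} {w} (≡ᵛ-intro eq) = ≡ᵛ-intro λ i →
  subst (_ ∣_) (negate-minus (lookup u i) (lookup w i)) (∣m⇒∣-m (eq i))
  where
  negate-minus : ∀ a b → - (a - b) ≡ b - a
  negate-minus = solve-∀

≡ᵛ-trans : u ≡ᵛ v mod M → v ≡ᵛ w mod M → u ≡ᵛ w mod M
≡ᵛ-trans {u = u} {v = v} {w = w} (≡ᵛ-intro eq₁) (≡ᵛ-intro eq₂) = ≡ᵛ-intro λ i →
  subst (_ ∣_) (ℤₚ.+-minus-telescope (lookup u i) (lookup v i) (lookup w i)) (∣m∣n⇒∣m+n (eq₁ i) (eq₂ i))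

≡ᵛ-weaken : ∀ {M′} → M′ ∣ M → u ≡ᵛ w mod M → u ≡ᵛ w mod M′
≡ᵛ-weaken M′∣M (≡ᵛ-intro eq) = ≡ᵛ-intro λ i → ∣-trans M′∣M (eq i)

≡ᵛ-setoid : ℕ → ℤ → Setoid _ _
≡ᵛ-setoid N M = record
  { Carrier       = Vec ℤ N
  ; _≈_           = λ u w → u ≡ᵛ w mod M
  ; isEquivalence = record { refl = ≡ᵛ-refl ; sym = ≡ᵛ-sym ; trans = ≡ᵛ-trans }
  }

module ≡ᵛ-Reasoning {N} (M : ℤ) = SetoidReasoning (≡ᵛ-setoid N M)

·ᵛ-identity : ∀ (u : Vec ℤ N) → + 1 ·ᵛ u ≡ u
·ᵛ-identity u = lookup-ext λ i → trans (lookup-·ᵛ (+ 1) u i) (ℤₚ.*-identityˡ (lookup u i))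

·ᵛ-assoc : ∀ k l (u : Vec ℤ N) → k ·ᵛ l ·ᵛ u ≡ (k * l) ·ᵛ u
·ᵛ-assoc k l u = lookup-ext λ i → begin
  lookup (k ·ᵛ l ·ᵛ u) i ≡⟨ lookup-·ᵛ k (l ·ᵛ u) i ⟩
  k * lookup (l ·ᵛ u) i  ≡⟨ cong (k *_) (lookup-·ᵛ l u i) ⟩
  k * (l * lookup u i)   ≡⟨ ℤₚ.*-assoc k l (lookup u i) ⟨
  k * l * lookup u i     ≡⟨ lookup-·ᵛ (k * l) u i ⟨
  lookup ((k * l) ·ᵛ u) i ∎
  where open ≡-Reasoning

·ᵛ-distribʳ-+ : ∀ k l (u : Vec ℤ N) → (k + l) ·ᵛ u ≡ k ·ᵛ u +ᵛ l ·ᵛ u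
·ᵛ-distribʳ-+ k l u = lookup-ext λ i → begin
  lookup ((k + l) ·ᵛ u) i                    ≡⟨ lookup-·ᵛ (k + l) u i ⟩
  (k + l) * lookup u i                       ≡⟨ ℤₚ.*-distribʳ-+ (lookup u i) k l ⟩
  k * lookup u i + l * lookup u i            ≡⟨ cong₂ _+_ (lookup-·ᵛ k u i) (lookup-·ᵛ l u i) ⟨
  lookup (k ·ᵛ u) i + lookup (l ·ᵛ u) i      ≡⟨ lookup-+ᵛ (k ·ᵛ u) (l ·ᵛ u) i ⟨
  lookup (k ·ᵛ u +ᵛ l ·ᵛ u) i                ∎
  where open ≡-Reasoning

·ᵛ-distribˡ-+ᵛ : ∀ k (u w : Vec ℤ N) → k ·ᵛ (u +ᵛ w) ≡ k ·ᵛ u +ᵛ k ·ᵛ w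
·ᵛ-distribˡ-+ᵛ k u w = lookup-ext λ i → begin
  lookup (k ·ᵛ (u +ᵛ w)) i                   ≡⟨ lookup-·ᵛ k (u +ᵛ w) i ⟩
  k * lookup (u +ᵛ w) i                      ≡⟨ cong (k *_) (lookup-+ᵛ u w i) ⟩
  k * (lookup u i + lookup w i)              ≡⟨ ℤₚ.*-distribˡ-+ k (lookup u i) (lookup w i) ⟩
  k * lookup u i + k * lookup w i            ≡⟨ cong₂ _+_ (lookup-·ᵛ k u i) (lookup-·ᵛ k w i) ⟨
  lookup (k ·ᵛ u) i + lookup (k ·ᵛ w) i      ≡⟨ lookup-+ᵛ (k ·ᵛ u) (k ·ᵛ w) i ⟨
  lookup (k ·ᵛ u +ᵛ k ·ᵛ w) i                ∎
  where open ≡-Reasoning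

∣ᵛ⇒≡·ᵛ : M ∣ᵛ u → Σ (Vec ℤ N) λ α → u ≡ M ·ᵛ α
∣ᵛ⇒≡·ᵛ {M = M} {u = u} (∣ᵛ-intro d) = α , lookup-ext λ i → begin
  lookup u i                  ≡⟨ _∣_.equality (d i) ⟩
  _∣_.quotient (d i) * M      ≡⟨ ℤₚ.*-comm _ M ⟩
  M * _∣_.quotient (d i)      ≡⟨ cong (M *_) (lookup∘tabulate _ i) ⟨
  M * lookup α i              ≡⟨ lookup-·ᵛ M α i ⟨
  lookup (M ·ᵛ α) i           ∎
  where
  open ≡-Reasoning
  α = tabulate λ i → _∣_.quotient (d i)

∣ᵛ-·ᵛ : M ∣ k → M ∣ᵛ k ·ᵛ u
∣ᵛ-·ᵛ {k = k} {u = u} M∣k = ∣ᵛ-intro λ i → subst (_ ∣_) (sym (lookup-·ᵛ k u i)) (∣m⇒∣m*n (lookup u i) M∣k)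

+ᵛ-·ᵛ-≡ᵛ : ∀ (u α : Vec ℤ N) → u +ᵛ M ·ᵛ α ≡ᵛ u mod M
+ᵛ-·ᵛ-≡ᵛ {M = M} u α = ≡ᵛ-intro λ i → divides (lookup α i) (begin
  lookup (u +ᵛ M ·ᵛ α) i - lookup u i        ≡⟨ cong (_- lookup u i) (trans (lookup-+ᵛ u (M ·ᵛ α) i)
                                                                       (cong (_+_ (lookup u i)) (lookup-·ᵛ M α i))) ⟩
  (lookup u i + M * lookup α i) - lookup u i ≡⟨ cancel (lookup u i) M (lookup α i) ⟩
  lookup α i * M                             ∎)
  where
  open ≡-Reasoning
  cancel : ∀ a m x → (a + m * x) - a ≡ x * m
  cancel = solve-∀

-ᵛ≡⇒≡+ᵛ : x -ᵛ y ≡ u → x ≡ y +ᵛ u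
-ᵛ≡⇒≡+ᵛ {x = x} {y} refl = lookup-ext λ i →
  trans (regroup (lookup x i) (lookup y i))
        (sym (trans (lookup-+ᵛ y (x -ᵛ y) i) (cong (_+_ (lookup y i)) (lookup--ᵛ x y i))))
  where
  regroup : ∀ a b → a ≡ b + (a - b)
  regroup = solve-∀

≡ᵛ-∣ᵛ : u ≡ᵛ w mod M → M ∣ᵛ w → M ∣ᵛ u
≡ᵛ-∣ᵛ {u = u} {w} (≡ᵛ-intro eq) (∣ᵛ-intro d) = ∣ᵛ-intro λ i →
  subst (_ ∣_) (minus-plus (lookup u i) (lookup w i)) (∣m∣n⇒∣m+n (eq i) (d i))
  where
  minus-plus : ∀ a b → (a - b) + b ≡ a
  minus-plus = solve-∀

-ᵛ-telescope-mod : x -ᵛ y ≡ᵛ u mod M → y -ᵛ v ≡ᵛ w mod M → x -ᵛ v ≡ᵛ u +ᵛ w mod M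
-ᵛ-telescope-mod {x = x} {y} {u = u} {v = v} {w = w} (≡ᵛ-intro eq₁) (≡ᵛ-intro eq₂) = ≡ᵛ-intro λ i →
  subst (_ ∣_) (trans (telescope (lookup x i) (lookup y i) (lookup v i) (lookup u i) (lookup w i))
                      (sym (cong₂ _-_ (lookup--ᵛ x v i) (lookup-+ᵛ u w i))))
    (∣m∣n⇒∣m+n (subst (_ ∣_) (cong (_- lookup u i) (lookup--ᵛ x y i)) (eq₁ i))
               (subst (_ ∣_) (cong (_- lookup w i) (lookup--ᵛ y v i)) (eq₂ i)))
  where
  telescope : ∀ a b c d e → ((a - b) - d) + ((b - c) - e) ≡ (a - c) - (d + e)
  telescope = solve-∀

+ᵛ-cong-mod : x ≡ᵛ y mod M → u ≡ᵛ w mod M → x +ᵛ u ≡ᵛ y +ᵛ w mod M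
+ᵛ-cong-mod {x = x} {y} {u = u} {w = w} (≡ᵛ-intro eq₁) (≡ᵛ-intro eq₂) = ≡ᵛ-intro λ i →
  subst (_ ∣_) (trans (+-minus-interchange (lookup x i) (lookup y i) (lookup u i) (lookup w i))
                      (sym (cong₂ _-_ (lookup-+ᵛ x u i) (lookup-+ᵛ y w i))))
    (∣m∣n⇒∣m+n (eq₁ i) (eq₂ i))

·ᵛ-cong-mod : ∀ k → u ≡ᵛ w mod M → k ·ᵛ u ≡ᵛ k ·ᵛ w mod M * k
·ᵛ-cong-mod {u = u} {w} k (≡ᵛ-intro eq) = ≡ᵛ-intro λ i →
  subst (_ ∣_) (trans (factor (lookup u i) (lookup w i) k) (sym (cong₂ _-_ (lookup-·ᵛ k u i) (lookup-·ᵛ k w i))))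
    (*-monoˡ-∣ k (eq i))
  where
  factor : ∀ a b k → (a - b) * k ≡ k * a - k * b
  factor = solve-∀

·ᵛ-cancel-mod : ∀ k .{{_ : ℤ.NonZero k}} → k ·ᵛ u ≡ᵛ k ·ᵛ w mod M * k → u ≡ᵛ w mod M
·ᵛ-cancel-mod {u = u} {w} {M} k (≡ᵛ-intro eq) = ≡ᵛ-intro λ i →
  *-cancelʳ-∣ k (subst (_ ∣_)
    (trans (cong₂ _-_ (lookup-·ᵛ k u i) (lookup-·ᵛ k w i)) (factor (lookup u i) (lookup w i) k)) (eq i))
  where
  factor : ∀ a b k → k * a - k * b ≡ (a - b) * k
  factor = solve-∀

∂ : Poly N → Vec ℤ N → Vec ℤ N → ℤ
∂ (con _) x u = 0ℤ
∂ (var i) x u = lookup u i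
∂ (p ⊕ q) x u = ∂ p x u + ∂ q x u
∂ (p ⊗ q) x u = ∂ p x u * eval q x + eval p x * ∂ q x u

eval-cong : ∀ (p : Poly N) → x ≡ᵛ y mod M → M ∣ eval p x - eval p y
eval-cong (con c) _ = ∣i-i c
eval-cong (var i) (≡ᵛ-intro eq) = eq i
eval-cong {x = x} {y} (p ⊕ q) eq =
  subst (_ ∣_) (+-minus-interchange (eval p x) (eval p y) (eval q x) (eval q y))
    (∣m∣n⇒∣m+n (eval-cong p eq) (eval-cong q eq))
eval-cong {x = x} {y} (p ⊗ q) eq =
  subst (_ ∣_) (product-of-differences (eval p x) (eval p y) (eval q x) (eval q y))
    (∣m∣n⇒∣m+n (∣m⇒∣m*n (eval q x) (eval-cong p eq)) (∣n⇒∣m*n (eval p y) (eval-cong q eq)))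
  where
  product-of-differences : ∀ a b c d → (a - b) * c + b * (c - d) ≡ a * c - b * d
  product-of-differences = solve-∀

∂-∣ : ∀ (p : Poly N) x → M ∣ᵛ u → M ∣ ∂ p x u
∂-∣ (con _) x _ = divides 0ℤ refl
∂-∣ (var i) x (∣ᵛ-intro d) = d i
∂-∣ (p ⊕ q) x d = ∣m∣n⇒∣m+n (∂-∣ p x d) (∂-∣ q x d)
∂-∣ (p ⊗ q) x d = ∣m∣n⇒∣m+n (∣m⇒∣m*n (eval q x) (∂-∣ p x d)) (∣n⇒∣m*n (eval p x) (∂-∣ q x d))

∂--ᵛ : ∀ (p : Poly N) x u w → ∂ p x (u -ᵛ w) ≡ ∂ p x u - ∂ p x w
∂--ᵛ (con _) x u w = refl
∂--ᵛ (var i) x u w = lookup--ᵛ u w i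
∂--ᵛ (p ⊕ q) x u w rewrite ∂--ᵛ p x u w | ∂--ᵛ q x u w =
  +-minus-interchange (∂ p x u) (∂ p x w) (∂ q x u) (∂ q x w)
∂--ᵛ (p ⊗ q) x u w rewrite ∂--ᵛ p x u w | ∂--ᵛ q x u w =
  distrib (∂ p x u) (∂ p x w) (∂ q x u) (∂ q x w) (eval q x) (eval p x)
  where
  distrib : ∀ a b c d e f → (a - b) * e + f * (c - d) ≡ (a * e + f * c) - (b * e + f * d)
  distrib = solve-∀

∂-·ᵛ : ∀ (p : Poly N) x k u → ∂ p x (k ·ᵛ u) ≡ k * ∂ p x u
∂-·ᵛ (con _) x k u = sym (ℤₚ.*-zeroʳ k)
∂-·ᵛ (var i) x k u = lookup-·ᵛ k u i
∂-·ᵛ (p ⊕ q) x k u rewrite ∂-·ᵛ p x k u | ∂-·ᵛ q x k u = sym (ℤₚ.*-distribˡ-+ k (∂ p x u) (∂ q x u))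
∂-·ᵛ (p ⊗ q) x k u rewrite ∂-·ᵛ p x k u | ∂-·ᵛ q x k u =
  distrib k (∂ p x u) (∂ q x u) (eval q x) (eval p x)
  where
  distrib : ∀ k a b e f → k * a * e + f * (k * b) ≡ k * (a * e + f * b)
  distrib = solve-∀

∂-cong-base : ∀ (p : Poly N) {x x′} u → x ≡ᵛ x′ mod M → c ∣ᵛ u → M * c ∣ ∂ p x u - ∂ p x′ u
∂-cong-base (con _) u _ _ = divides 0ℤ refl
∂-cong-base (var i) u _ _ = ∣i-i (lookup u i)
∂-cong-base (p ⊕ q) {x} {x′} u eq d =
  subst (_ ∣_) (+-minus-interchange (∂ p x u) (∂ p x′ u) (∂ q x u) (∂ q x′ u))
    (∣m∣n⇒∣m+n (∂-cong-base p u eq d) (∂-cong-base q u eq d))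
∂-cong-base (p ⊗ q) {x} {x′} u eq d =
  subst (_ ∣_) (leibniz (∂ p x u) (∂ p x′ u) (eval q x) (eval q x′) (eval p x) (eval p x′) (∂ q x u) (∂ q x′ u))
    (∣m∣n⇒∣m+n (∣m∣n⇒∣m+n (∣-* (eval-cong q eq) (∂-∣ p x d)) (∣m⇒∣m*n (eval q x′) (∂-cong-base p u eq d)))
               (∣m∣n⇒∣m+n (∣-* (eval-cong p eq) (∂-∣ q x d)) (∣n⇒∣m*n (eval p x′) (∂-cong-base q u eq d))))
  where
  leibniz : ∀ a a′ b b′ e e′ f f′ →
    ((b - b′) * a + (a - a′) * b′) + ((e - e′) * f + e′ * (f - f′)) ≡ (a * b + e * f) - (a′ * b′ + e′ * f′)
  leibniz = solve-∀

taylor : ∀ (p : Poly N) → c ∣ᵛ y -ᵛ x → c * c ∣ eval p y - eval p x - ∂ p x (y -ᵛ x)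
taylor (con k) _ = subst (_ ∣_) (sym (vanish k)) (divides 0ℤ refl)
  where
  vanish : ∀ k → k - k - 0ℤ ≡ 0ℤ
  vanish = solve-∀
taylor {y = y} {x} (var i) _ =
  subst (_ ∣_) (sym (vanish (lookup y i) (lookup x i) (lookup--ᵛ y x i))) (divides 0ℤ refl)
  where
  vanish : ∀ a b {d} → d ≡ a - b → a - b - d ≡ 0ℤ
  vanish a b refl = ℤₚ.+-inverseʳ (a - b)
taylor {y = y} {x} (p ⊕ q) d =
  subst (_ ∣_) (distrib (eval p y) (eval p x) (eval q y) (eval q x) (∂ p x (y -ᵛ x)) (∂ q x (y -ᵛ x)))
    (∣m∣n⇒∣m+n (taylor p d) (taylor q d))
  where
  distrib : ∀ a b c d e f → (a - b - e) + (c - d - f) ≡ (a + c) - (b + d) - (e + f)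
  distrib = solve-∀
taylor {y = y} {x} (p ⊗ q) d =
  subst (_ ∣_) (leibniz (eval p y) (eval p x) (eval q y) (eval q x) (∂ p x (y -ᵛ x)) (∂ q x (y -ᵛ x)))
    (∣m∣n⇒∣m+n (∣m∣n⇒∣m+n (∣m⇒∣m*n (eval q y) (taylor p d))
                           (∣-* (∂-∣ p x d) (eval-cong q (∣ᵛ-ᵛ⇒≡ᵛ d))))
               (∣n⇒∣m*n (eval p x) (taylor q d)))
  where
  leibniz : ∀ py px qy qx dp dq →
    ((py - px - dp) * qy + dp * (qy - qx)) + px * (qy - qx - dq) ≡ py * qy - px * qx - (dp * qx + px * dq)
  leibniz = solve-∀

jacobian : Endo N → Vec ℤ N → Vec ℤ N → Vec ℤ N
jacobian f x u = tabulate (λ i → ∂ (f i) x u)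

record IsLinear (L : Vec ℤ N → Vec ℤ N) : Set where
  field
    -ᵛ-hom        : ∀ u w → L (u -ᵛ w) ≡ L u -ᵛ L w
    ·ᵛ-hom        : ∀ k u → L (k ·ᵛ u) ≡ k ·ᵛ L u
    ∣ᵛ-preserving : M ∣ᵛ u → M ∣ᵛ L u

  ≡ᵛ-preserving : u ≡ᵛ w mod M → L u ≡ᵛ L w mod M
  ≡ᵛ-preserving {u = u} {w} eq = ∣ᵛ-ᵛ⇒≡ᵛ (subst (_ ∣ᵛ_) (-ᵛ-hom u w) (∣ᵛ-preserving (≡ᵛ⇒∣ᵛ-ᵛ eq)))

open IsLinear public

jacobian-linear : ∀ (f : Endo N) x → IsLinear (jacobian f x)
jacobian-linear f x = record
  { -ᵛ-hom        = λ u w → lookup-ext λ i → begin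
      lookup (jacobian f x (u -ᵛ w)) i                       ≡⟨ lookup∘tabulate _ i ⟩
      ∂ (f i) x (u -ᵛ w)                                     ≡⟨ ∂--ᵛ (f i) x u w ⟩
      ∂ (f i) x u - ∂ (f i) x w                              ≡⟨ cong₂ _-_ (lookup∘tabulate _ i) (lookup∘tabulate _ i) ⟨
      lookup (jacobian f x u) i - lookup (jacobian f x w) i  ≡⟨ lookup--ᵛ (jacobian f x u) (jacobian f x w) i ⟨
      lookup (jacobian f x u -ᵛ jacobian f x w) i            ∎
  ; ·ᵛ-hom        = λ k u → lookup-ext λ i → begin
      lookup (jacobian f x (k ·ᵛ u)) i   ≡⟨ lookup∘tabulate _ i ⟩
      ∂ (f i) x (k ·ᵛ u)                 ≡⟨ ∂-·ᵛ (f i) x k u ⟩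
      k * ∂ (f i) x u                    ≡⟨ cong (k *_) (lookup∘tabulate _ i) ⟨
      k * lookup (jacobian f x u) i      ≡⟨ lookup-·ᵛ k (jacobian f x u) i ⟨
      lookup (k ·ᵛ jacobian f x u) i     ∎
  ; ∣ᵛ-preserving = λ d → ∣ᵛ-intro λ i → subst (_ ∣_) (sym (lookup∘tabulate _ i)) (∂-∣ (f i) x d)
  }
  where open ≡-Reasoning

id-linear : IsLinear {N} (λ u → u)
id-linear = record { -ᵛ-hom = λ _ _ → refl ; ·ᵛ-hom = λ _ _ → refl ; ∣ᵛ-preserving = λ d → d }

∘-linear : ∀ {L L′ : Vec ℤ N → Vec ℤ N} → IsLinear L → IsLinear L′ → IsLinear (L ∘ L′)
∘-linear {L = L} {L′} lin lin′ = record
  { -ᵛ-hom        = λ u w → trans (cong L (-ᵛ-hom lin′ u w)) (-ᵛ-hom lin (L′ u) (L′ w))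
  ; ·ᵛ-hom        = λ k u → trans (cong L (·ᵛ-hom lin′ k u)) (·ᵛ-hom lin k (L′ u))
  ; ∣ᵛ-preserving = ∣ᵛ-preserving lin ∘ ∣ᵛ-preserving lin′
  }

infixr 8 _^[_]_

_^[_]_ : ∀ {A : Set} → (A → A) → ℕ → A → A
L ^[ k ] u = fold u L k

^-linear : ∀ {L : Vec ℤ N → Vec ℤ N} → IsLinear L → ∀ k → IsLinear (L ^[ k ]_)
^-linear lin zero    = id-linear
^-linear lin (suc k) = ∘-linear lin (^-linear lin k)

^-+ : ∀ {A : Set} (L : A → A) a b u → L ^[ a ℕ.+ b ] u ≡ L ^[ a ] L ^[ b ] u
^-+ L a b u = fold-+ u L a

lookup-apply : ∀ (f : Endo N) x i → lookup (apply f x) i ≡ eval (f i) x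
lookup-apply f x i = lookup∘tabulate _ i

apply-cong : ∀ (f : Endo N) → x ≡ᵛ y mod M → apply f x ≡ᵛ apply f y mod M
apply-cong {x = x} {y} f eq = ≡ᵛ-intro λ i →
  subst (_ ∣_) (sym (cong₂ _-_ (lookup-apply f x i) (lookup-apply f y i))) (eval-cong (f i) eq)

iter-cong : ∀ (f : Endo N) s → x ≡ᵛ y mod M → iter f s x ≡ᵛ iter f s y mod M
iter-cong f zero    eq = eq
iter-cong f (suc s) eq = apply-cong f (iter-cong f s eq)

iter-+ : ∀ (f : Endo N) a b x → iter f (a ℕ.+ b) x ≡ iter f a (iter f b x)
iter-+ f zero    b x = refl
iter-+ f (suc a) b x = cong (apply f) (iter-+ f a b x)

iter-*-periodic : ∀ (f : Endo N) {P} n → iter f n P ≡ P → ∀ k → iter f (k ℕ.* n) P ≡ P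
iter-*-periodic f n per zero    = refl
iter-*-periodic f {P} n per (suc k) = begin
  iter f (n ℕ.+ k ℕ.* n) P    ≡⟨ iter-+ f n (k ℕ.* n) P ⟩
  iter f n (iter f (k ℕ.* n) P) ≡⟨ cong (iter f n) (iter-*-periodic f n per k) ⟩
  iter f n P                  ≡⟨ per ⟩
  P                           ∎
  where open ≡-Reasoning

apply-taylor : ∀ (f : Endo N) → c ∣ᵛ y -ᵛ x → apply f y -ᵛ apply f x ≡ᵛ jacobian f x (y -ᵛ x) mod c * c
apply-taylor {y = y} {x} f d = ≡ᵛ-intro λ i → subst (_ ∣_) (sym (cong₂ _-_
    (trans (lookup--ᵛ (apply f y) (apply f x) i) (cong₂ _-_ (lookup-apply f y i) (lookup-apply f x i)))
    (lookup∘tabulate _ i)))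
  (taylor (f i) d)

jacobian-cong-base : ∀ (f : Endo N) {x x′} u → x ≡ᵛ x′ mod M → c ∣ᵛ u →
                     jacobian f x u ≡ᵛ jacobian f x′ u mod M * c
jacobian-cong-base f u eq d = ≡ᵛ-intro λ i →
  subst (_ ∣_) (sym (cong₂ _-_ (lookup∘tabulate _ i) (lookup∘tabulate _ i))) (∂-cong-base (f i) u eq d)

iterJacobian : Endo N → Vec ℤ N → ℕ → Vec ℤ N → Vec ℤ N
iterJacobian f P zero    = λ u → u
iterJacobian f P (suc s) = jacobian f (iter f s P) ∘ iterJacobian f P s

iterJacobian-linear : ∀ (f : Endo N) P s → IsLinear (iterJacobian f P s)
iterJacobian-linear f P zero    = id-linear
iterJacobian-linear f P (suc s) = ∘-linear (jacobian-linear f (iter f s P)) (iterJacobian-linear f P s)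

-- First-order Taylor expansion of f^s: the quadratic error is divisible by c * c, hence by M * c.
iter-linearization : ∀ (f : Endo N) P s → M ∣ c → x ≡ᵛ P mod M → c ∣ᵛ y -ᵛ x →
                     iter f s y -ᵛ iter f s x ≡ᵛ iterJacobian f P s (y -ᵛ x) mod M * c
iter-linearization f P zero    M∣c x≡P d = ≡ᵛ-refl
iter-linearization {M = M} {c} {x = x} {y} f P (suc s) M∣c x≡P d = begin
  apply f Y -ᵛ apply f X                        ≈⟨ ≡ᵛ-weaken (*-monoˡ-∣ c M∣c) (apply-taylor f dₛ) ⟩
  jacobian f X (Y -ᵛ X)                         ≈⟨ jacobian-cong-base f (Y -ᵛ X) (iter-cong f s x≡P) dₛ ⟩
  jacobian f (iter f s P) (Y -ᵛ X)              ≈⟨ ≡ᵛ-preserving (jacobian-linear f (iter f s P))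
                                                     (iter-linearization f P s M∣c x≡P d) ⟩
  iterJacobian f P (suc s) (y -ᵛ x)             ∎
  where
  open ≡ᵛ-Reasoning (M * c)
  X = iter f s x
  Y = iter f s y
  dₛ : c ∣ᵛ Y -ᵛ X
  dₛ = ≡ᵛ⇒∣ᵛ-ᵛ (iter-cong f s (∣ᵛ-ᵛ⇒≡ᵛ d))

module _ (q : ℕ) .{{_ : NonZero q}} where

  residue : ℤ → Fin q
  residue x = fromℕ< (n%ℕd<d x q)

  residue-injective-mod : ∀ x y → residue x ≡ residue y → + q ∣ x - y
  residue-injective-mod x y eq = divides (x /ℕ q - y /ℕ q) (begin
    x - y
      ≡⟨ cong₂ _-_ (a≡a%ℕn+[a/ℕn]*n x q) (a≡a%ℕn+[a/ℕn]*n y q) ⟩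
    (+ (x %ℕ q) + x /ℕ q * + q) - (+ (y %ℕ q) + y /ℕ q * + q)
      ≡⟨ cong (λ r → (+ r + x /ℕ q * + q) - (+ (y %ℕ q) + y /ℕ q * + q)) same-remainder ⟩
    (+ (y %ℕ q) + x /ℕ q * + q) - (+ (y %ℕ q) + y /ℕ q * + q)
      ≡⟨ cancel (+ (y %ℕ q)) (x /ℕ q) (y /ℕ q) (+ q) ⟩
    (x /ℕ q - y /ℕ q) * + q
      ∎)
    where
    open ≡-Reasoning
    same-remainder : x %ℕ q ≡ y %ℕ q
    same-remainder = trans (sym (Finₚ.toℕ-fromℕ< (n%ℕd<d x q)))
                       (trans (cong toℕ eq) (Finₚ.toℕ-fromℕ< (n%ℕd<d y q)))
    cancel : ∀ r a b c → (r + a * c) - (r + b * c) ≡ (a - b) * c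
    cancel = solve-∀

  residues : Vec ℤ N → Fin (q ℕ.^ N)
  residues []       = Fin.zero
  residues (x ∷ xs) = combine (residue x) (residues xs)

  residues-injective-mod : ∀ (u w : Vec ℤ N) → residues u ≡ residues w → u ≡ᵛ w mod + q
  residues-injective-mod []       []       eq = ≡ᵛ-intro λ ()
  residues-injective-mod (x ∷ xs) (y ∷ ys) eq = ≡ᵛ-intro λ where
      Fin.zero    → residue-injective-mod x y (cong proj₁ split)
      (Fin.suc i) → ≡ᵛ-at (residues-injective-mod xs ys (cong proj₂ split)) i
    where
    split : (residue x , residues xs) ≡ (residue y , residues ys)
    split = trans (sym (Finₚ.remQuot-combine (residue x) (residues xs)))
              (trans (cong (remQuot _) eq) (Finₚ.remQuot-combine (residue y) (residues ys)))

  pigeonhole-mod : ∀ (s : ℕ → Vec ℤ N) → ∃₂ λ i j → i < j × j ≤ q ℕ.^ N × s i ≡ᵛ s j mod + q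
  pigeonhole-mod {N} s with Finₚ.pigeonhole (ℕₚ.n<1+n (q ℕ.^ N)) (residues ∘ s ∘ toℕ)
  ... | i , j , i<j , eq =
    toℕ i , toℕ j , i<j , ℕₚ.≤-pred (Finₚ.toℕ<n j) , residues-injective-mod (s (toℕ i)) (s (toℕ j)) eq

n<3^n : ∀ n → n < 3 ℕ.^ n
n<3^n zero    = z<s
n<3^n (suc n) = ℕₚ.≤-<-trans (n<3^n n)
  (subst (3 ℕ.^ n <_) (ℕₚ.*-comm (3 ℕ.^ n) 3) (ℕₚ.m<m*n (3 ℕ.^ n) 3 {{ℕₚ.m^n≢0 3 n}} (ℕ.s≤s (ℕ.s≤s ℕ.z≤n))))

n∣n! : ∀ n .{{_ : NonZero n}} → n ∣ₙ n !
n∣n! (suc n) = ℕ∣.m∣m*n (n !)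

module _ {L : Vec ℤ N → Vec ℤ N} (lin : IsLinear L) {z : Vec ℤ N} where

  ^-shift-mod : ∀ i j → L ^[ i ] z ≡ᵛ L ^[ j ] z mod M → ∀ t →
                L ^[ t ℕ.+ i ] z ≡ᵛ L ^[ t ℕ.+ j ] z mod M
  ^-shift-mod {M = M} i j eq t = begin
    L ^[ t ℕ.+ i ] z     ≡⟨ ^-+ L t i z ⟩
    L ^[ t ] L ^[ i ] z  ≈⟨ ≡ᵛ-preserving (^-linear lin t) eq ⟩
    L ^[ t ] L ^[ j ] z  ≡⟨ ^-+ L t j z ⟨
    L ^[ t ℕ.+ j ] z     ∎
    where open ≡ᵛ-Reasoning M

  ^-periodic-mod : ∀ i d → L ^[ i ] z ≡ᵛ L ^[ i ℕ.+ d ] z mod M → ∀ r →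
                   L ^[ i ] z ≡ᵛ L ^[ i ℕ.+ r ℕ.* d ] z mod M
  ^-periodic-mod i d eq zero = ≡ᵛ-reflexive (cong (λ e → L ^[ e ] z) (sym (ℕₚ.+-identityʳ i)))
  ^-periodic-mod {M = M} i d eq (suc r) = begin
    L ^[ i ] z                     ≈⟨ ^-periodic-mod i d eq r ⟩
    L ^[ i ℕ.+ r ℕ.* d ] z         ≡⟨ cong (λ e → L ^[ e ] z) (ℕₚ.+-comm i (r ℕ.* d)) ⟩
    L ^[ r ℕ.* d ℕ.+ i ] z         ≈⟨ ^-shift-mod i (i ℕ.+ d) eq (r ℕ.* d) ⟩
    L ^[ r ℕ.* d ℕ.+ (i ℕ.+ d) ] z ≡⟨ cong (λ e → L ^[ e ] z) (rearrange i d r) ⟩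
    L ^[ i ℕ.+ suc r ℕ.* d ] z     ∎
    where
    open ≡ᵛ-Reasoning M
    rearrange : ∀ i d r → r ℕ.* d ℕ.+ (i ℕ.+ d) ≡ i ℕ.+ suc r ℕ.* d
    rearrange = ℕ-Solver.solve-∀

  ^-eventually-periodic-mod : ∀ i d {a b} → L ^[ i ] z ≡ᵛ L ^[ i ℕ.+ d ] z mod M → i ≤ a → d ∣ₙ b →
                              L ^[ a ] z ≡ᵛ L ^[ a ℕ.+ b ] z mod M
  ^-eventually-periodic-mod {M = M} i d {a} eq i≤a (divides-refl r) = begin
    L ^[ a ] z                           ≡⟨ cong (λ e → L ^[ e ] z) (ℕₚ.m∸n+n≡m i≤a) ⟨
    L ^[ (a ∸ i) ℕ.+ i ] z               ≈⟨ ^-shift-mod i (i ℕ.+ r ℕ.* d) (^-periodic-mod i d eq r) (a ∸ i) ⟩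
    L ^[ (a ∸ i) ℕ.+ (i ℕ.+ r ℕ.* d) ] z ≡⟨ cong (λ e → L ^[ e ] z) regroup ⟩
    L ^[ a ℕ.+ r ℕ.* d ] z               ∎
    where
    open ≡ᵛ-Reasoning M
    regroup : (a ∸ i) ℕ.+ (i ℕ.+ r ℕ.* d) ≡ a ℕ.+ r ℕ.* d
    regroup = trans (sym (ℕₚ.+-assoc (a ∸ i) i (r ℕ.* d))) (cong (ℕ._+ r ℕ.* d) (ℕₚ.m∸n+n≡m i≤a))

  ^-stable-mod : ∀ q .{{_ : NonZero q}} {a} → (q ℕ.^ N) ! ∣ₙ a → 0 < a →
                 L ^[ a ] z ≡ᵛ L ^[ (q ℕ.^ N) ! ] z mod + q
  ^-stable-mod q (divides-refl zero)    ()
  ^-stable-mod q (divides-refl (suc k)) _ with pigeonhole-mod q (λ t → L ^[ t ] z)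
  ... | i , j , i<j , j≤q^N , eq =
    ≡ᵛ-sym (^-eventually-periodic-mod i (j ∸ i) eq′ i≤E (ℕ∣.∣-trans d∣E (ℕ∣.n∣m*n k)))
    where
    instance
      q^N≢0 : NonZero (q ℕ.^ N)
      q^N≢0 = ℕₚ.m^n≢0 q N
      d≢0 : NonZero (j ∸ i)
      d≢0 = ℕ.>-nonZero (ℕₚ.m<n⇒0<n∸m i<j)
    eq′ : L ^[ i ] z ≡ᵛ L ^[ i ℕ.+ (j ∸ i) ] z mod + q
    eq′ = subst (λ e → L ^[ i ] z ≡ᵛ L ^[ e ] z mod + q) (sym (ℕₚ.m+[n∸m]≡n (ℕₚ.<⇒≤ i<j))) eq
    i≤E : i ≤ (q ℕ.^ N) !
    i≤E = ℕₚ.≤-trans (ℕₚ.<⇒≤ (ℕₚ.<-≤-trans i<j j≤q^N)) (ℕ∣.∣⇒≤ {{(q ℕ.^ N) ℕₚ.!≢0}} (n∣n! (q ℕ.^ N)))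
    d∣E : j ∸ i ∣ₙ (q ℕ.^ N) !
    d∣E = ℕ∣.∣-trans (n∣n! (j ∸ i)) (ℕ∣.m≤n⇒m!∣n! (ℕₚ.≤-trans (ℕₚ.m∸n≤m j i) j≤q^N))

module _ (p : ℕ) (1<p : 1 < p) where

  private
    divide-out : ∀ fuel (W : Vec ℤ N) i → lookup W i ≢ 0ℤ → ∣ lookup W i ∣ < fuel →
                 ∃₂ λ b w → W ≡ + (p ℕ.^ b) ·ᵛ w × ¬ (+ p ∣ᵛ w)
    divide-out (suc fuel) W i Wᵢ≢0 bound with Finₚ.all? (λ j → + p ∣? lookup W j)
    ... | no ¬p∣W = 0 , W , sym (·ᵛ-identity W) , λ p∣W → ¬p∣W (∣ᵛ-at p∣W)
    ... | yes p∣W = lift (divide-out fuel W′ i W′ᵢ≢0 bound′)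
      where
      W′ : Vec ℤ _
      W′ = tabulate λ j → _∣_.quotient (p∣W j)
      W≡pW′ : ∀ j → lookup W j ≡ lookup W′ j * + p
      W≡pW′ j = trans (_∣_.equality (p∣W j)) (cong (_* + p) (sym (lookup∘tabulate _ j)))
      W′ᵢ≢0 : lookup W′ i ≢ 0ℤ
      W′ᵢ≢0 W′ᵢ≡0 = Wᵢ≢0 (trans (W≡pW′ i) (cong (_* + p) W′ᵢ≡0))
      bound′ : ∣ lookup W′ i ∣ < fuel
      bound′ = ℕₚ.<-≤-trans
        (ℕₚ.m<m*n ∣ lookup W′ i ∣ p {{ℕ.≢-nonZero (W′ᵢ≢0 ∘ ℤₚ.∣i∣≡0⇒i≡0)}} 1<p)
        (subst (_≤ fuel) (trans (cong ∣_∣ (W≡pW′ i)) (ℤₚ.abs-* (lookup W′ i) (+ p))) (ℕₚ.≤-pred bound))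
      lift : (∃₂ λ b w → W′ ≡ + (p ℕ.^ b) ·ᵛ w × ¬ (+ p ∣ᵛ w)) →
             ∃₂ λ b w → W ≡ + (p ℕ.^ b) ·ᵛ w × ¬ (+ p ∣ᵛ w)
      lift (b , w , W′≡pᵇw , ¬p∣w) = suc b , w , W≡pᵇ⁺¹w , ¬p∣w
        where
        open ≡-Reasoning
        W≡pᵇ⁺¹w : W ≡ + (p ℕ.^ suc b) ·ᵛ w
        W≡pᵇ⁺¹w = begin
          W                            ≡⟨ lookup-ext (λ j → trans (W≡pW′ j)
                                            (trans (ℤₚ.*-comm _ (+ p)) (sym (lookup-·ᵛ (+ p) W′ j)))) ⟩
          + p ·ᵛ W′                    ≡⟨ cong (+ p ·ᵛ_) W′≡pᵇw ⟩
          + p ·ᵛ + (p ℕ.^ b) ·ᵛ w      ≡⟨ ·ᵛ-assoc (+ p) (+ (p ℕ.^ b)) w ⟩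
          (+ p * + (p ℕ.^ b)) ·ᵛ w     ≡⟨ cong (_·ᵛ w) (ℤₚ.pos-* p (p ℕ.^ b)) ⟨
          + (p ℕ.^ suc b) ·ᵛ w         ∎

  factor-out-power : ∀ (W : Vec ℤ N) i → lookup W i ≢ 0ℤ → ∃₂ λ b w → W ≡ + (p ℕ.^ b) ·ᵛ w × ¬ (+ p ∣ᵛ w)
  factor-out-power W i Wᵢ≢0 = divide-out (suc ∣ lookup W i ∣) W i Wᵢ≢0 ℕₚ.≤-refl

idempotent-mod-lift : ∀ {B : Vec ℤ N → Vec ℤ N} → IsLinear B → (∀ v → B (B v) ≡ᵛ B v mod M) →
                      M ∣ᵛ u → B (B u) ≡ᵛ B u mod M * M
idempotent-mod-lift {M = M} {B = B} lin idem M∣u with ∣ᵛ⇒≡·ᵛ M∣u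
... | α , refl = begin
  B (B (M ·ᵛ α)) ≡⟨ cong B (·ᵛ-hom lin M α) ⟩
  B (M ·ᵛ B α)   ≡⟨ ·ᵛ-hom lin M (B α) ⟩
  M ·ᵛ B (B α)   ≈⟨ ·ᵛ-cong-mod M (idem α) ⟩
  M ·ᵛ B α       ≡⟨ ·ᵛ-hom lin M α ⟨
  B (M ·ᵛ α)     ∎
  where open ≡ᵛ-Reasoning (M * M)

sum-of-three-mod-9 : ∀ x₀ x₁ x₂ x₃ → + 3 ∣ x₁ - x₀ → + 3 ∣ x₂ - x₁ → + 9 ∣ (x₃ - x₂) - (x₂ - x₁) →
                     + 9 ∣ x₃ + x₂ + x₁ - + 3 * x₀
sum-of-three-mod-9 x₀ x₁ x₂ x₃ 3∣x₁-x₀ 3∣x₂-x₁ 9∣Δ² =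
  subst (_ ∣_) (regroup x₀ x₁ x₂ x₃) (∣m∣n⇒∣m+n 9∣Δ² (∣-* (∣-refl {+ 3}) (∣m∣n⇒∣m+n 3∣x₂-x₁ 3∣x₁-x₀)))
  where
  regroup : ∀ x₀ x₁ x₂ x₃ → ((x₃ - x₂) - (x₂ - x₁)) + + 3 * ((x₂ - x₁) + (x₁ - x₀)) ≡ x₃ + x₂ + x₁ - + 3 * x₀
  regroup = solve-∀

module _ (f : Endo N) {P : Vec ℤ N} (n′ : ℕ) (periodic : iter f (suc n′) P ≡ P) where

  return-mod : ∀ {i j} → i < j → iter f i P ≡ᵛ iter f j P mod M → iter f (j ∸ i) P ≡ᵛ P mod M
  return-mod {M = M} {i} {j} i<j eq = begin
    iter f (j ∸ i) P                        ≡⟨ cong (iter f (j ∸ i)) full-turns ⟨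
    iter f (j ∸ i) (iter f (t ℕ.+ i) P)     ≡⟨ iter-+ f (j ∸ i) (t ℕ.+ i) P ⟨
    iter f ((j ∸ i) ℕ.+ (t ℕ.+ i)) P        ≡⟨ cong (λ e → iter f e P) shuffle ⟩
    iter f (t ℕ.+ j) P                      ≡⟨ iter-+ f t j P ⟩
    iter f t (iter f j P)                   ≈⟨ iter-cong f t (≡ᵛ-sym eq) ⟩
    iter f t (iter f i P)                   ≡⟨ iter-+ f t i P ⟨
    iter f (t ℕ.+ i) P                      ≡⟨ full-turns ⟩
    P                                       ∎
    where
    open ≡ᵛ-Reasoning M
    t : ℕ
    t = n′ ℕ.* i
    full-turns : iter f (t ℕ.+ i) P ≡ P
    full-turns = trans (cong (λ e → iter f e P) (turns n′ i)) (iter-*-periodic f (suc n′) periodic i)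
      where
      turns : ∀ n′ i → n′ ℕ.* i ℕ.+ i ≡ i ℕ.* suc n′
      turns = ℕ-Solver.solve-∀
    shuffle : (j ∸ i) ℕ.+ (t ℕ.+ i) ≡ t ℕ.+ j
    shuffle = trans (ℕₚ.+-comm (j ∸ i) (t ℕ.+ i))
                (trans (ℕₚ.+-assoc t i (j ∸ i)) (cong (t ℕ.+_) (ℕₚ.m+[n∸m]≡n (ℕₚ.<⇒≤ i<j))))

  returns-mod : ∀ q .{{_ : NonZero q}} → Σ ℕ λ m → 0 < m × m ≤ q ℕ.^ N × iter f m P ≡ᵛ P mod + q
  returns-mod q with pigeonhole-mod q (λ k → iter f k P)
  ... | i , j , i<j , j≤q^N , eq =
    j ∸ i , ℕₚ.m<n⇒0<n∸m i<j , ℕₚ.≤-trans (ℕₚ.m∸n≤m j i) j≤q^N , return-mod i<j eq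

module PeriodicOrbit {N} (f : Endo N) (P : Vec ℤ N) (n′ : ℕ) (periodic : iter f (suc n′) P ≡ P) where

  n : ℕ
  n = suc n′

  private
    return-mod-9 = returns-mod f n′ periodic 9

  m : ℕ
  m = proj₁ return-mod-9

  0<m : 0 < m
  0<m = proj₁ (proj₂ return-mod-9)

  m≤9^N : m ≤ 9 ℕ.^ N
  m≤9^N = proj₁ (proj₂ (proj₂ return-mod-9))

  Q : ℕ → Vec ℤ N
  Q k = iter f (k ℕ.* m) P

  Q-suc : ∀ k → Q (suc k) ≡ iter f m (Q k)
  Q-suc k = iter-+ f m (k ℕ.* m) P

  Q-+ : ∀ a b → Q (a ℕ.+ b) ≡ iter f (a ℕ.* m) (Q b)
  Q-+ a b = trans (cong (λ e → iter f e P) (ℕₚ.*-distribʳ-+ m a b)) (iter-+ f (a ℕ.* m) (b ℕ.* m) P)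

  Q-periodic : ∀ a k → Q (a ℕ.+ k ℕ.* n) ≡ Q a
  Q-periodic a k = trans (Q-+ a (k ℕ.* n)) (cong (iter f (a ℕ.* m)) Q-kn≡P)
    where
    swap : ∀ k n m → k ℕ.* n ℕ.* m ≡ k ℕ.* m ℕ.* n
    swap = ℕ-Solver.solve-∀
    Q-kn≡P : Q (k ℕ.* n) ≡ P
    Q-kn≡P = trans (cong (λ e → iter f e P) (swap k n m)) (iter-*-periodic f n periodic (k ℕ.* m))

  fᵐP≡P : iter f m P ≡ᵛ P mod + 9
  fᵐP≡P = proj₂ (proj₂ (proj₂ return-mod-9))

  Q≡P : ∀ k → Q k ≡ᵛ P mod + 9
  Q≡P zero    = ≡ᵛ-refl
  Q≡P (suc k) = begin
    Q (suc k)       ≡⟨ Q-suc k ⟩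
    iter f m (Q k)  ≈⟨ iter-cong f m (Q≡P k) ⟩
    iter f m P      ≈⟨ fᵐP≡P ⟩
    P               ∎
    where open ≡ᵛ-Reasoning (+ 9)

  Λ : Vec ℤ N → Vec ℤ N
  Λ = iterJacobian f P m

  Λ-linear : IsLinear Λ
  Λ-linear = iterJacobian-linear f P m

  Q-linearization : ∀ {c} i j → + 9 ∣ c → c ∣ᵛ Q j -ᵛ Q i → ∀ k →
                    Q (k ℕ.+ j) -ᵛ Q (k ℕ.+ i) ≡ᵛ Λ ^[ k ] (Q j -ᵛ Q i) mod + 9 * c
  Q-linearization i j 9∣c c∣Qj-Qi zero    = ≡ᵛ-refl
  Q-linearization {c} i j 9∣c c∣Qj-Qi (suc k) = begin
    Q (suc k ℕ.+ j) -ᵛ Q (suc k ℕ.+ i)               ≡⟨ cong₂ _-ᵛ_ (Q-suc (k ℕ.+ j)) (Q-suc (k ℕ.+ i)) ⟩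
    iter f m (Q (k ℕ.+ j)) -ᵛ iter f m (Q (k ℕ.+ i)) ≈⟨ iter-linearization f P m 9∣c (Q≡P (k ℕ.+ i)) c∣Δₖ ⟩
    Λ (Q (k ℕ.+ j) -ᵛ Q (k ℕ.+ i))                   ≈⟨ ≡ᵛ-preserving Λ-linear
                                                          (Q-linearization i j 9∣c c∣Qj-Qi k) ⟩
    Λ ^[ suc k ] (Q j -ᵛ Q i)                        ∎
    where
    open ≡ᵛ-Reasoning (+ 9 * c)
    c∣Δₖ : c ∣ᵛ Q (k ℕ.+ j) -ᵛ Q (k ℕ.+ i)
    c∣Δₖ = ≡ᵛ⇒∣ᵛ-ᵛ (subst₂ (λ a b → a ≡ᵛ b mod c) (sym (Q-+ k j)) (sym (Q-+ k i))
                      (iter-cong f (k ℕ.* m) (∣ᵛ-ᵛ⇒≡ᵛ c∣Qj-Qi)))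

  E : ℕ
  E = (3 ℕ.^ N) !

  Λ-stable : ∀ {a} z → E ∣ₙ a → 0 < a → Λ ^[ a ] z ≡ᵛ Λ ^[ E ] z mod + 3
  Λ-stable z = ^-stable-mod Λ-linear 3

  module Lift (F : ℕ) (F-stable : ∀ k z → Λ ^[ suc k ℕ.* F ] z ≡ᵛ Λ ^[ F ] z mod + 3)
              (ν : ℕ) (w : Vec ℤ N) where

    δ : ℤ
    δ = + (3 ℕ.^ (2 ℕ.+ ν))

    instance
      δ≢0 : ℤ.NonZero δ
      δ≢0 = ℕₚ.m^n≢0 3 (2 ℕ.+ ν)

    9∣δ : + 9 ∣ δ
    9∣δ = divides (+ (3 ℕ.^ ν)) (trans (cong +_ (regroup (3 ℕ.^ ν))) (ℤₚ.pos-* (3 ℕ.^ ν) 9))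
      where
      regroup : ∀ x → 3 ℕ.* (3 ℕ.* x) ≡ x ℕ.* 9
      regroup = ℕ-Solver.solve-∀

    3δ∣9δ : + 3 * δ ∣ + 9 * δ
    3δ∣9δ = divides (+ 3) (regroup δ)
      where
      regroup : ∀ d → + 9 * d ≡ + 3 * (+ 3 * d)
      regroup = solve-∀

    b : ℕ → Vec ℤ N
    b k = Λ ^[ k ℕ.* F ] w

    b-suc : ∀ k → b (suc k) ≡ Λ ^[ F ] b k
    b-suc k = ^-+ Λ F (k ℕ.* F) w

    module _ (Q-F : Q F -ᵛ P ≡ δ ·ᵛ w) where

      Q-step : ∀ k → Q (suc k ℕ.* F) -ᵛ Q (k ℕ.* F) ≡ᵛ δ ·ᵛ b k mod + 9 * δ
      Q-step k = begin
        Q (suc k ℕ.* F) -ᵛ Q (k ℕ.* F)           ≡⟨ cong₂ _-ᵛ_ (cong Q (ℕₚ.+-comm F (k ℕ.* F)))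
                                                              (cong Q (sym (ℕₚ.+-identityʳ (k ℕ.* F)))) ⟩
        Q (k ℕ.* F ℕ.+ F) -ᵛ Q (k ℕ.* F ℕ.+ 0)   ≈⟨ Q-linearization 0 F 9∣δ δ∣QF-P (k ℕ.* F) ⟩
        Λ ^[ k ℕ.* F ] (Q F -ᵛ P)                ≡⟨ cong (Λ ^[ k ℕ.* F ]_) Q-F ⟩
        Λ ^[ k ℕ.* F ] (δ ·ᵛ w)                  ≡⟨ ·ᵛ-hom (^-linear Λ-linear (k ℕ.* F)) δ w ⟩
        δ ·ᵛ b k                                 ∎
        where
        open ≡ᵛ-Reasoning (+ 9 * δ)
        δ∣QF-P : δ ∣ᵛ Q F -ᵛ P
        δ∣QF-P = subst (δ ∣ᵛ_) (sym Q-F) (∣ᵛ-·ᵛ ∣-refl)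

      -- By periodicity Q-step n is Q-F again; cancel δ.
      Λ-fixes-w : Λ ^[ F ] w ≡ᵛ w mod + 3
      Λ-fixes-w = begin
        Λ ^[ F ] w           ≈⟨ F-stable n′ w ⟨
        Λ ^[ n ℕ.* F ] w     ≈⟨ ≡ᵛ-weaken (divides (+ 3) refl) (·ᵛ-cancel-mod δ δw≡δΛⁿᶠw) ⟨
        w                    ∎
        where
        open ≡ᵛ-Reasoning (+ 3)
        δw≡δΛⁿᶠw : δ ·ᵛ w ≡ᵛ δ ·ᵛ Λ ^[ n ℕ.* F ] w mod + 9 * δ
        δw≡δΛⁿᶠw = subst (λ v → v ≡ᵛ δ ·ᵛ Λ ^[ n ℕ.* F ] w mod + 9 * δ)
          (trans (cong₂ _-ᵛ_ (trans (cong (λ e → Q (F ℕ.+ e)) (ℕₚ.*-comm n F)) (Q-periodic F F))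
                             (trans (cong Q (ℕₚ.*-comm n F)) (Q-periodic 0 F)))
                 Q-F)
          (Q-step n)

      b≡w : ∀ k → b k ≡ᵛ w mod + 3
      b≡w zero    = ≡ᵛ-refl
      b≡w (suc k) = ≡ᵛ-trans (F-stable k w) Λ-fixes-w

      first-order : ∀ k → Q (k ℕ.* F) -ᵛ P ≡ᵛ (+ k * δ) ·ᵛ w mod + 3 * δ
      first-order zero = ≡ᵛ-intro λ i → subst (_ ∣_) (sym (vanish i)) (divides 0ℤ refl)
        where
        vanish : ∀ i → lookup (P -ᵛ P) i - lookup ((+ 0 * δ) ·ᵛ w) i ≡ 0ℤ
        vanish i = trans (cong₂ _-_ (lookup--ᵛ P P i) (lookup-·ᵛ (+ 0 * δ) w i))
                         (simplify (lookup P i) δ (lookup w i))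
          where
          simplify : ∀ a d x → (a - a) - + 0 * d * x ≡ 0ℤ
          simplify = solve-∀
      first-order (suc k) = begin
        Q (suc k ℕ.* F) -ᵛ P                          ≈⟨ -ᵛ-telescope-mod (≡ᵛ-weaken 3δ∣9δ (Q-step k))
                                                                          (first-order k) ⟩
        δ ·ᵛ b k +ᵛ (+ k * δ) ·ᵛ w                    ≈⟨ +ᵛ-cong-mod (·ᵛ-cong-mod δ (b≡w k)) ≡ᵛ-refl ⟩
        δ ·ᵛ w +ᵛ (+ k * δ) ·ᵛ w                      ≡⟨ ·ᵛ-distribʳ-+ δ (+ k * δ) w ⟨
        (δ + + k * δ) ·ᵛ w                            ≡⟨ cong (_·ᵛ w) (regroup (+ k) δ) ⟩
        (+ suc k * δ) ·ᵛ w                            ∎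
        where
        open ≡ᵛ-Reasoning (+ 3 * δ)
        regroup : ∀ k d → d + k * d ≡ (+ 1 + k) * d
        regroup = solve-∀

      -- Λ^F is idempotent modulo 3, hence modulo 9 on b 1 - b 0, which is divisible by 3.
      three-steps : b 3 +ᵛ b 2 +ᵛ b 1 ≡ᵛ + 3 ·ᵛ w mod + 9
      three-steps = ≡ᵛ-intro λ i → subst (_ ∣_)
          (sym (cong₂ _-_ (trans (lookup-+ᵛ (b 3 +ᵛ b 2) (b 1) i)
                                 (cong (_+ lookup (b 1) i) (lookup-+ᵛ (b 3) (b 2) i)))
                          (lookup-·ᵛ (+ 3) w i)))
          (sum-of-three-mod-9 (lookup w i) (lookup (b 1) i) (lookup (b 2) i) (lookup (b 3) i)
            (≡ᵛ-at b₁≡b₀ i)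
            (subst (_ ∣_) (lookup--ᵛ (b 2) (b 1) i) (∣ᵛ-at 3∣b₂-b₁ i))
            (subst₂ (λ x y → + 9 ∣ x - y) (lookup--ᵛ (b 3) (b 2) i) (lookup--ᵛ (b 2) (b 1) i) (≡ᵛ-at Δ² i)))
        where
        B-linear : IsLinear (Λ ^[ F ]_)
        B-linear = ^-linear Λ-linear F
        b₁≡b₀ : b 1 ≡ᵛ w mod + 3
        b₁≡b₀ = b≡w 1
        B-Δ : ∀ k → Λ ^[ F ] (b (suc k) -ᵛ b k) ≡ b (suc (suc k)) -ᵛ b (suc k)
        B-Δ k = trans (-ᵛ-hom B-linear (b (suc k)) (b k)) (sym (cong₂ _-ᵛ_ (b-suc (suc k)) (b-suc k)))
        B-idempotent : ∀ v → Λ ^[ F ] Λ ^[ F ] v ≡ᵛ Λ ^[ F ] v mod + 3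
        B-idempotent v = subst (λ x → x ≡ᵛ Λ ^[ F ] v mod + 3)
          (trans (cong (λ e → Λ ^[ F ℕ.+ e ] v) (ℕₚ.+-identityʳ F)) (^-+ Λ F F v)) (F-stable 1 v)
        3∣b₂-b₁ : + 3 ∣ᵛ b 2 -ᵛ b 1
        3∣b₂-b₁ = subst (_ ∣ᵛ_) (B-Δ 0) (∣ᵛ-preserving B-linear (≡ᵛ⇒∣ᵛ-ᵛ b₁≡b₀))
        Δ² : b 3 -ᵛ b 2 ≡ᵛ b 2 -ᵛ b 1 mod + 9
        Δ² = subst₂ (λ x y → x ≡ᵛ y mod + 9) (trans (cong (Λ ^[ F ]_) (B-Δ 0)) (B-Δ 1)) (B-Δ 0)
          (idempotent-mod-lift B-linear B-idempotent (≡ᵛ⇒∣ᵛ-ᵛ b₁≡b₀))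

      Q-kF≡P : ∀ k → Q (k ℕ.* F) ≡ᵛ P mod δ
      Q-kF≡P k = ∣ᵛ-ᵛ⇒≡ᵛ (≡ᵛ-∣ᵛ (≡ᵛ-weaken (∣n⇒∣m*n (+ 3) ∣-refl) (first-order k)) (∣ᵛ-·ᵛ (∣n⇒∣m*n (+ k) ∣-refl)))

      Q-4F-1F : Q (4 ℕ.* F) -ᵛ Q (1 ℕ.* F) ≡ᵛ (+ 3 * δ) ·ᵛ w mod + 9 * δ
      Q-4F-1F = begin
        Q (4 ℕ.* F) -ᵛ Q (1 ℕ.* F)           ≈⟨ -ᵛ-telescope-mod (-ᵛ-telescope-mod (Q-step 3) (Q-step 2))
                                                                 (Q-step 1) ⟩
        δ ·ᵛ b 3 +ᵛ δ ·ᵛ b 2 +ᵛ δ ·ᵛ b 1     ≡⟨ trans (·ᵛ-distribˡ-+ᵛ δ (b 3 +ᵛ b 2) (b 1))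
                                                    (cong (_+ᵛ δ ·ᵛ b 1) (·ᵛ-distribˡ-+ᵛ δ (b 3) (b 2))) ⟨
        δ ·ᵛ (b 3 +ᵛ b 2 +ᵛ b 1)             ≈⟨ ·ᵛ-cong-mod δ three-steps ⟩
        δ ·ᵛ + 3 ·ᵛ w                        ≡⟨ ·ᵛ-assoc δ (+ 3) w ⟩
        (δ * + 3) ·ᵛ w                       ≡⟨ cong (_·ᵛ w) (ℤₚ.*-comm δ (+ 3)) ⟩
        (+ 3 * δ) ·ᵛ w                       ∎
        where open ≡ᵛ-Reasoning (+ 9 * δ)

      -- n′F further steps of g carry Q (4F) - Q F back to Q (3F) - P; they act as Λ^(n′F),
      -- which fixes w modulo 3.
      second-order : Q (3 ℕ.* F) -ᵛ P ≡ᵛ (+ 3 * δ) ·ᵛ w mod + 9 * δ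
      second-order = begin
        Q (3 ℕ.* F) -ᵛ P                                      ≡⟨ cong₂ _-ᵛ_ Q-shifted-4F Q-shifted-1F ⟨
        Q (n′ ℕ.* F ℕ.+ 4 ℕ.* F) -ᵛ Q (n′ ℕ.* F ℕ.+ 1 ℕ.* F)  ≈⟨ Q-linearization (1 ℕ.* F) (4 ℕ.* F) 9∣δ
                                                                   δ∣Q4F-Q1F (n′ ℕ.* F) ⟩
        Λ ^[ n′ ℕ.* F ] (Q (4 ℕ.* F) -ᵛ Q (1 ℕ.* F))          ≈⟨ ≡ᵛ-preserving Λⁿ′ᶠ-linear Q-4F-1F ⟩
        Λ ^[ n′ ℕ.* F ] ((+ 3 * δ) ·ᵛ w)                      ≡⟨ ·ᵛ-hom Λⁿ′ᶠ-linear (+ 3 * δ) w ⟩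
        (+ 3 * δ) ·ᵛ Λ ^[ n′ ℕ.* F ] w                        ≈⟨ ≡ᵛ-weaken (∣-reflexive (ℤₚ.*-assoc (+ 3) (+ 3) δ))
                                                                   (·ᵛ-cong-mod (+ 3 * δ) (b≡w n′)) ⟩
        (+ 3 * δ) ·ᵛ w                                        ∎
        where
        open ≡ᵛ-Reasoning (+ 9 * δ)
        Λⁿ′ᶠ-linear : IsLinear (Λ ^[ n′ ℕ.* F ]_)
        Λⁿ′ᶠ-linear = ^-linear Λ-linear (n′ ℕ.* F)
        δ∣Q4F-Q1F : δ ∣ᵛ Q (4 ℕ.* F) -ᵛ Q (1 ℕ.* F)
        δ∣Q4F-Q1F = ≡ᵛ⇒∣ᵛ-ᵛ (≡ᵛ-trans (Q-kF≡P 4) (≡ᵛ-sym (Q-kF≡P 1)))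
        shift₄ : ∀ n′ F → n′ ℕ.* F ℕ.+ 4 ℕ.* F ≡ 3 ℕ.* F ℕ.+ F ℕ.* suc n′
        shift₄ = ℕ-Solver.solve-∀
        shift₁ : ∀ n′ F → n′ ℕ.* F ℕ.+ 1 ℕ.* F ≡ F ℕ.* suc n′
        shift₁ = ℕ-Solver.solve-∀
        Q-shifted-4F : Q (n′ ℕ.* F ℕ.+ 4 ℕ.* F) ≡ Q (3 ℕ.* F)
        Q-shifted-4F = trans (cong Q (shift₄ n′ F)) (Q-periodic (3 ℕ.* F) F)
        Q-shifted-1F : Q (n′ ℕ.* F ℕ.+ 1 ℕ.* F) ≡ P
        Q-shifted-1F = trans (cong Q (shift₁ n′ F)) (Q-periodic 0 F)

      order-divisible : ∀ q → Q (q ℕ.* F) ≡ P → ¬ (+ 3 ∣ᵛ w) → 3 ∣ₙ q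
      order-divisible q Q-qF≡P 3∤w with 3 ℕ∣.∣? q
      ... | yes 3∣q = 3∣q
      ... | no  3∤q = ⊥-elim (3∤w (∣ᵛ-intro λ i → prime-∣-*-coprime 3-prime (3∣qwᵢ i) 3∤q))
        where
        3-prime : Prime 3
        3-prime = toWitness {a? = prime? 3} _
        P-P≡qδw : P -ᵛ P ≡ᵛ (+ q * δ) ·ᵛ w mod + 3 * δ
        P-P≡qδw = subst (λ x → x -ᵛ P ≡ᵛ (+ q * δ) ·ᵛ w mod + 3 * δ) Q-qF≡P (first-order q)
        simplify : ∀ a k d x → - ((a - a) - k * d * x) ≡ k * x * d
        simplify = solve-∀
        3∣qwᵢ : ∀ i → + 3 ∣ + q * lookup w i
        3∣qwᵢ i = *-cancelʳ-∣ δ (subst (_ ∣_)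
          (trans (cong -_ (cong₂ _-_ (lookup--ᵛ P P i) (lookup-·ᵛ (+ q * δ) w i)))
                 (simplify (lookup P i) (+ q) δ (lookup w i)))
          (∣m⇒∣-m (≡ᵛ-at P-P≡qδw i)))

      next-level : Σ (Vec ℤ N) λ w′ → Q (3 ℕ.* F) -ᵛ P ≡ + (3 ℕ.^ (2 ℕ.+ suc ν)) ·ᵛ w′ × w′ ≡ᵛ w mod + 3
      next-level = refine (∣ᵛ⇒≡·ᵛ (≡ᵛ⇒∣ᵛ-ᵛ second-order))
        where
        regroup : ∀ d → + 9 * d ≡ (+ 3 * d) * + 3
        regroup = solve-∀
        refine : Σ (Vec ℤ N) (λ α → Q (3 ℕ.* F) -ᵛ P -ᵛ (+ 3 * δ) ·ᵛ w ≡ (+ 9 * δ) ·ᵛ α) →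
                 Σ (Vec ℤ N) λ w′ → Q (3 ℕ.* F) -ᵛ P ≡ + (3 ℕ.^ (2 ℕ.+ suc ν)) ·ᵛ w′ × w′ ≡ᵛ w mod + 3
        refine (α , excess) = w +ᵛ + 3 ·ᵛ α , Q-3F-P , +ᵛ-·ᵛ-≡ᵛ w α
          where
          open ≡-Reasoning
          Q-3F-P : Q (3 ℕ.* F) -ᵛ P ≡ + (3 ℕ.^ (2 ℕ.+ suc ν)) ·ᵛ (w +ᵛ + 3 ·ᵛ α)
          Q-3F-P = begin
            Q (3 ℕ.* F) -ᵛ P                            ≡⟨ -ᵛ≡⇒≡+ᵛ excess ⟩
            (+ 3 * δ) ·ᵛ w +ᵛ (+ 9 * δ) ·ᵛ α            ≡⟨ cong ((+ 3 * δ) ·ᵛ w +ᵛ_) (trans (cong (_·ᵛ α) (regroup δ))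
                                                                 (sym (·ᵛ-assoc (+ 3 * δ) (+ 3) α))) ⟩
            (+ 3 * δ) ·ᵛ w +ᵛ (+ 3 * δ) ·ᵛ + 3 ·ᵛ α     ≡⟨ ·ᵛ-distribˡ-+ᵛ (+ 3 * δ) w (+ 3 ·ᵛ α) ⟨
            (+ 3 * δ) ·ᵛ (w +ᵛ + 3 ·ᵛ α)                ≡⟨ cong (_·ᵛ (w +ᵛ + 3 ·ᵛ α))
                                                                 (ℤₚ.pos-* 3 (3 ℕ.^ (2 ℕ.+ ν))) ⟨
            + (3 ℕ.^ (2 ℕ.+ suc ν)) ·ᵛ (w +ᵛ + 3 ·ᵛ α)  ∎

  Displacement : ℕ → Set
  Displacement s = Σ ℕ λ ν → Σ (Vec ℤ N) λ w → Q (3 ℕ.^ s ℕ.* E) -ᵛ P ≡ + (3 ℕ.^ (2 ℕ.+ ν)) ·ᵛ w × ¬ (+ 3 ∣ᵛ w)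

  Λ-stable-at : ∀ s k z → Λ ^[ suc k ℕ.* (3 ℕ.^ s ℕ.* E) ] z ≡ᵛ Λ ^[ 3 ℕ.^ s ℕ.* E ] z mod + 3
  Λ-stable-at s k z =
    ≡ᵛ-trans (Λ-stable z (ℕ∣.∣-trans E∣F (ℕ∣.n∣m*n (suc k))) (ℕₚ.<-≤-trans F>0 (ℕₚ.m≤m+n F (k ℕ.* F))))
             (≡ᵛ-sym (Λ-stable z E∣F F>0))
    where
    F = 3 ℕ.^ s ℕ.* E
    E∣F : E ∣ₙ F
    E∣F = ℕ∣.n∣m*n (3 ℕ.^ s)
    F>0 : 0 < F
    F>0 = ℕ.>-nonZero⁻¹ F {{ℕₚ.m*n≢0 (3 ℕ.^ s) E {{ℕₚ.m^n≢0 3 s}} {{(3 ℕ.^ N) ℕₚ.!≢0}}}}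

  displacement-step : ∀ s → Displacement s → Displacement (suc s)
  displacement-step s (ν , w , Q-F , 3∤w) = suc ν , w′ , Q-3F′ , 3∤w′
    where
    open Lift (3 ℕ.^ s ℕ.* E) (Λ-stable-at s) ν w using (next-level)
    w′ : Vec ℤ N
    w′ = proj₁ (next-level Q-F)
    Q-3F′ : Q (3 ℕ.^ suc s ℕ.* E) -ᵛ P ≡ + (3 ℕ.^ (2 ℕ.+ suc ν)) ·ᵛ w′
    Q-3F′ = trans (cong (λ e → Q e -ᵛ P) (ℕₚ.*-assoc 3 (3 ℕ.^ s) E)) (proj₁ (proj₂ (next-level Q-F)))
    3∤w′ : ¬ (+ 3 ∣ᵛ w′)
    3∤w′ 3∣w′ = 3∤w (≡ᵛ-∣ᵛ (≡ᵛ-sym (proj₂ (proj₂ (next-level Q-F)))) 3∣w′)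

  period-divisible : ∀ s → Displacement s → 3 ℕ.^ s ∣ₙ n → 3 ℕ.^ suc s ∣ₙ n
  period-divisible s (ν , w , Q-F , 3∤w) (ℕ∣.divides q n≡q3ˢ) =
    subst (3 ℕ.^ suc s ∣ₙ_) (sym n≡q3ˢ)
      (ℕ∣.*-monoˡ-∣ (3 ℕ.^ s) (Lift.order-divisible (3 ℕ.^ s ℕ.* E) (Λ-stable-at s) ν w Q-F q Q-qF≡P 3∤w))
    where
    Q-qF≡P : Q (q ℕ.* (3 ℕ.^ s ℕ.* E)) ≡ P
    Q-qF≡P = trans (cong Q (trans (sym (ℕₚ.*-assoc q (3 ℕ.^ s) E))
                                  (trans (cong (ℕ._* E) (sym n≡q3ˢ)) (ℕₚ.*-comm n E))))
                   (Q-periodic 0 E)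

  initial-displacement : Q E ≢ P → Displacement 0
  initial-displacement Q-E≢P =
    from-valuation (factor-out-power 3 (ℕ.s≤s (ℕ.s≤s ℕ.z≤n)) W (proj₁ W≢0) (proj₂ W≢0))
    where
    W = Q (1 ℕ.* E) -ᵛ P
    W≢0 : ∃ λ i → lookup W i ≢ 0ℤ
    W≢0 = ≢⇒lookup--ᵛ≢0 (Q-E≢P ∘ trans (cong Q (sym (ℕₚ.+-identityʳ E))))
    9∣W : + 9 ∣ᵛ W
    9∣W = ≡ᵛ⇒∣ᵛ-ᵛ (Q≡P (1 ℕ.* E))
    -- W ≡ 0 (mod 9) rules out the valuations 0 and 1.
    from-valuation : (∃₂ λ b w → W ≡ + (3 ℕ.^ b) ·ᵛ w × ¬ (+ 3 ∣ᵛ w)) → Displacement 0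
    from-valuation (zero , w , W≡w , 3∤w) = ⊥-elim (3∤w (∣ᵛ-intro λ i →
      ∣-trans (divides (+ 3) refl)
        (subst (_ ∣_) (trans (lookup-·ᵛ (+ 1) w i) (ℤₚ.*-identityˡ _)) (∣ᵛ-at (subst (_ ∣ᵛ_) W≡w 9∣W) i))))
    from-valuation (suc zero , w , W≡3w , 3∤w) = ⊥-elim (3∤w (∣ᵛ-intro λ i →
      *-cancelˡ-∣ (+ 3) (subst (_ ∣_) (lookup-·ᵛ (+ 3) w i) (∣ᵛ-at (subst (_ ∣ᵛ_) W≡3w 9∣W) i))))
    from-valuation (suc (suc ν) , w , W≡ , 3∤w) = ν , w , W≡ , 3∤w

  Q-E≡P : Q E ≡ P
  Q-E≡P with ≡-dec ℤ._≟_ (Q E) P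
  ... | yes Q-E≡P = Q-E≡P
  ... | no  Q-E≢P = ⊥-elim (ℕₚ.<⇒≱ (n<3^n n) (ℕ∣.∣⇒≤ (proj₂ (descent n))))
    where
    descent : ∀ s → Displacement s × 3 ℕ.^ s ∣ₙ n
    descent zero    = initial-displacement Q-E≢P , ℕ∣.1∣ n
    descent (suc s) with descent s
    ... | d , 3ˢ∣n = displacement-step s d , period-divisible s d 3ˢ∣n

Unique⇒lookup-≢ : ∀ {A : Set} {xs : List A} → Unique xs → ∀ {i j} → i Fin.< j → List.lookup xs i ≢ List.lookup xs j
Unique⇒lookup-≢ {xs = _ ∷ xs} (x∉xs ∷ _) {Fin.zero}  {Fin.suc j} _ = All.lookup x∉xs (∈-lookup {xs = xs} j)
Unique⇒lookup-≢ (_ ∷ unique)              {Fin.suc i} {Fin.suc j} (ℕ.s≤s i<j) = Unique⇒lookup-≢ unique i<j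

Unique-image⇒length≤ : ∀ {A : Set} {M} (g : Fin M → A) {xs : List A} → Unique xs →
                      All (λ x → ∃ λ r → g r ≡ x) xs → length xs ≤ M
Unique-image⇒length≤ {M = M} g {xs} unique in-image with length xs ℕ.≤? M
... | yes ≤M = ≤M
... | no  ≰M = ⊥-elim (collision (Finₚ.pigeonhole (ℕₚ.≰⇒> ≰M) (proj₁ ∘ preimage)))
  where
  preimage : ∀ i → ∃ λ r → g r ≡ List.lookup xs i
  preimage i = All.lookup in-image (∈-lookup {xs = xs} i)
  collision : ¬ (∃₂ λ i j → i Fin.< j × proj₁ (preimage i) ≡ proj₁ (preimage j))
  collision (i , j , i<j , same) = Unique⇒lookup-≢ unique i<j
    (trans (sym (proj₂ (preimage i))) (trans (cong g same) (proj₂ (preimage j))))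

orbit-size : ∀ (f : Endo N) P M .{{_ : NonZero M}} → iter f M P ≡ P → OrbitSizeAtMost f P M
orbit-size f P M periodic xs unique in-orbit =
  Unique-image⇒length≤ (λ r → iter f (toℕ r) P) unique (All.map reduce in-orbit)
  where
  reduce : ∀ {x} → InOrbit f P x → ∃ λ r → iter f (toℕ r) P ≡ x
  reduce (k , refl) = fromℕ< (m%n<n k M) , (begin
    iter f (toℕ (fromℕ< (m%n<n k M))) P       ≡⟨ cong (λ e → iter f e P) (Finₚ.toℕ-fromℕ< (m%n<n k M)) ⟩
    iter f (k % M) P                          ≡⟨ cong (iter f (k % M)) (iter-*-periodic f M periodic (k / M)) ⟨
    iter f (k % M) (iter f (k / M ℕ.* M) P)   ≡⟨ iter-+ f (k % M) (k / M ℕ.* M) P ⟨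
    iter f (k % M ℕ.+ k / M ℕ.* M) P          ≡⟨ cong (λ e → iter f e P) (m≡m%n+[m/n]*n k M) ⟨
    iter f k P                                ∎)
    where open ≡-Reasoning

C : ℕ → ℕ
C N = (3 ℕ.^ N) ! ℕ.* 9 ℕ.^ N

theorem2p2 : Σ (ℕ → ℕ) (λ C → (N : ℕ) → 1 ≤ N → (0 < C N) ×
    ((f : Endo N) (P : Vec ℤ N) → Periodic f P → OrbitSizeAtMost f P (C N)))
theorem2p2 = C , λ N _ → C>0 N , bounded
  where
  C>0 : ∀ N → 0 < C N
  C>0 N = ℕ.>-nonZero⁻¹ (C N) {{ℕₚ.m*n≢0 ((3 ℕ.^ N) !) (9 ℕ.^ N) {{(3 ℕ.^ N) ℕₚ.!≢0}} {{ℕₚ.m^n≢0 9 N}}}}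
  bounded : ∀ {N} (f : Endo N) P → Periodic f P → OrbitSizeAtMost f P (C N)
  bounded f P (zero , () , _)
  bounded {N} f P (suc n′ , _ , periodic) xs unique in-orbit =
    ℕₚ.≤-trans (orbit-size f P (E ℕ.* m) {{Em≢0}} Q-E≡P xs unique in-orbit) (ℕₚ.*-monoʳ-≤ E m≤9^N)
    where
    open PeriodicOrbit f P n′ periodic
    Em≢0 : NonZero (E ℕ.* m)
    Em≢0 = ℕₚ.m*n≢0 E m {{(3 ℕ.^ N) ℕₚ.!≢0}} {{ℕ.>-nonZero 0<m}}
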